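{- Let $R:\mathcal A\rightsquigarrow\mathcal B$ and $S:\mathcal B\rightsquigarrow\mathcal C$ be modules between small $\mathcal V$-categories, with collages $(i^R_0,\mathrm{Coll}(R),i^R_1)$, $(i^S_0,\mathrm{Coll}(S),i^S_1)$ and $(i^{S\cdot R}_0,\mathrm{Coll}(S\cdot R),i^{S\cdot R}_1)$. Let $q_0:\mathrm{Coll}(S)\to i^S_1\triangleright i^R_0$ and $q_1:\mathrm{Coll}(R)\to i^S_1\triangleright i^R_0$ be the cocomma object of $i^S_1:\mathcal B\to\mathrm{Coll}(S)$ and $i^R_0:\mathcal B\to\mathrm{Coll}(R)$. Then there exists a fully faithful $\mathcal V$-functor $j:\mathrm{Coll}(S\cdot R)\to i^S_1\triangleright i^R_0$ with $j\cdot i^{S\cdot R}_0=q_0\cdot i^S_0$ and $j\cdot i^{S\cdot R}_1=q_1\cdot i^R_1$.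
   Context: $\mathcal V=(\mathcal V_o,\otimes,I,[-,-])$ is a commutative quantale: $\mathcal V_o$ a complete lattice (least element $\bot$), $\otimes$ commutative associative with unit $I$ preserving joins in each variable, $x\otimes y\le z$ iff $y\le[x,z]$. $\mathcal V$-categories have hom-values $\mathcal A(a,b)\in\mathcal V_o$ with $I\le\mathcal A(a,a)$, $\mathcal A(b,c)\otimes\mathcal A(a,b)\le\mathcal A(a,c)$; $\mathcal V$-functors satisfy $\mathcal A(a,a')\le\mathcal B(fa,fa')$ (fully faithful: equality); $f\le g$ iff $I\le\mathcal B(fa,ga)$ for all $a$. $\mathcal V\text{ -cat}$: 2-category of small $\mathcal V$-categories, $\mathcal V$-functors and $\le$. A module $R:\mathcal A\rightsquigarrow\mathcal B$ is a $\mathcal V$-functor $\mathcal B^{op}\otimes\mathcal A\to\mathcal V$; $(S\cdot R)(c,a)=\bigvee_bS(c,b)\otimes R(b,a)$. The collage $\mathrm{Coll}(R)$ of $R:\mathcal A\rightsquigarrow\mathcal B$ has objects the disjoint union of those of $\mathcal A$ and $\mathcal B$, homs $\mathcal A(a,a')$, $\mathcal B(b,b')$, $\mathrm{Coll}(R)(b,a)=R(b,a)$, $\mathrm{Coll}(R)(a,b)=\bot$, with inclusions $i_0:\mathcal B\to\mathrm{Coll}(R)$, $i_1:\mathcal A\to\mathrm{Coll}(R)$. The cocomma object of $f:\mathcal D\to\mathcal X$, $g:\mathcal D\to\mathcal Y$ is a $\mathcal V$-category $f\triangleright g$ with $\mathcal V$-functors $k_0:\mathcal X\to f\triangleright g$,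 $k_1:\mathcal Y\to f\triangleright g$, $k_0f\le k_1g$, such that for every $\mathcal Z$, composing with $(k_0,k_1)$ is an isomorphism of preorders from $\mathcal V$-functors $f\triangleright g\to\mathcal Z$ to pairs $(h,k)$ of $\mathcal V$-functors $h:\mathcal X\to\mathcal Z$, $k:\mathcal Y\to\mathcal Z$ with $hf\le kg$ (ordered componentwise). -}

module Defs where

open import Level using (Level; _⊔_) renaming (suc to lsuc)
open import Data.Sum using (_⊎_; inj₁; inj₂)
open import Data.Product using (Σ; _×_; _,_)
open import Data.Empty.Polymorphic using (⊥)
open import Relation.Binary using (Rel; IsPartialOrder)
open import Relation.Binary.PropositionalEquality using (_≡_; refl; sym; trans; cong; cong₂)

record Quantale (c ℓ i : Level) : Set (lsuc (c ⊔ ℓ ⊔ i)) where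
  infixr 7 _⊗_
  infix 4 _≤_
  field
    Carrier        : Set c
    _≤_            : Rel Carrier ℓ
    isPartialOrder : IsPartialOrder _≡_ _≤_
    ⋁              : {J : Set i} → (J → Carrier) → Carrier
    ⋁-upper        : {J : Set i} (f : J → Carrier) (k : J) → f k ≤ ⋁ f
    ⋁-least        : {J : Set i} (f : J → Carrier) (z : Carrier) →
                     ((k : J) → f k ≤ z) → ⋁ f ≤ z
    _⊗_            : Carrier → Carrier → Carrier
    unit           : Carrier
    ⊗-comm         : ∀ x y → x ⊗ y ≡ y ⊗ x
    ⊗-assoc        : ∀ x y z → (x ⊗ y) ⊗ z ≡ x ⊗ (y ⊗ z)
    ⊗-identityˡ    : ∀ x → unit ⊗ x ≡ x
    ⊗-⋁ʳ           : ∀ x {J : Set i} (f : J → Carrier) → x ⊗ ⋁ f ≡ ⋁ (λ k → x ⊗ f k)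
    ⊗-⋁ˡ           : ∀ x {J : Set i} (f : J → Carrier) → ⋁ f ⊗ x ≡ ⋁ (λ k → f k ⊗ x)
    [_,_]          : Carrier → Carrier → Carrier
    adj            : ∀ {x y z} → x ⊗ y ≤ z → y ≤ [ x , z ]
    adj⁻           : ∀ {x y z} → y ≤ [ x , z ] → x ⊗ y ≤ z

module _ {c ℓ i : Level} (V : Quantale c ℓ i) where
  open Quantale V

  private
    ≤-refl : ∀ {x} → x ≤ x
    ≤-refl = IsPartialOrder.refl isPartialOrder
    ≤-trans : ∀ {x y z} → x ≤ y → y ≤ z → x ≤ z
    ≤-trans = IsPartialOrder.trans isPartialOrder
    ≤-reflexive : ∀ {x y} → x ≡ y → x ≤ y
    ≤-reflexive = IsPartialOrder.reflexive isPartialOrder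

  ⊥V : Carrier
  ⊥V = ⋁ {J = ⊥} (λ ())

  private
    ⊗-monoʳ : ∀ {x y} z → x ≤ y → z ⊗ x ≤ z ⊗ y
    ⊗-monoʳ z x≤y = adj⁻ (≤-trans x≤y (adj ≤-refl))
    ⊗-monoˡ : ∀ {x y} z → x ≤ y → x ⊗ z ≤ y ⊗ z
    ⊗-monoˡ {x} {y} z x≤y =
      ≤-trans (≤-reflexive (⊗-comm x z))
        (≤-trans (⊗-monoʳ z x≤y) (≤-reflexive (⊗-comm z y)))
    ⊗-mono : ∀ {x x' y y'} → x ≤ x' → y ≤ y' → x ⊗ y ≤ x' ⊗ y'
    ⊗-mono {x' = x'} {y = y} p q = ≤-trans (⊗-monoˡ y p) (⊗-monoʳ x' q)
    ⊗⊥ : ∀ x z → x ⊗ ⊥V ≤ z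
    ⊗⊥ x z = adj⁻ (⋁-least (λ ()) [ x , z ] (λ ()))
    ⊥⊗ : ∀ x z → ⊥V ⊗ x ≤ z
    ⊥⊗ x z = ≤-trans (≤-reflexive (⊗-comm ⊥V x)) (⊗⊥ x z)
    unit≤ : ∀ {x y} → unit ≤ y → x ≤ y ⊗ x
    unit≤ {x} u = ≤-trans (≤-reflexive (sym (⊗-identityˡ x))) (⊗-monoˡ x u)
    ⋁⊗ : ∀ {J : Set i} (f : J → Carrier) y z → (∀ k → f k ⊗ y ≤ z) → ⋁ f ⊗ y ≤ z
    ⋁⊗ f y z h = ≤-trans (≤-reflexive (⊗-comm (⋁ f) y))
      (adj⁻ (⋁-least f [ y , z ] (λ k → adj (≤-trans (≤-reflexive (⊗-comm y (f k))) (h k)))))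
    interchange : ∀ x y z w → (x ⊗ y) ⊗ (z ⊗ w) ≡ (x ⊗ z) ⊗ (y ⊗ w)
    interchange x y z w =
      trans (⊗-assoc x y (z ⊗ w))
      (trans (cong (x ⊗_) (sym (⊗-assoc y z w)))
      (trans (cong (λ t → x ⊗ (t ⊗ w)) (⊗-comm y z))
      (trans (cong (x ⊗_) (⊗-assoc z y w))
      (sym (⊗-assoc x z (y ⊗ w))))))

  record VCat : Set (lsuc i ⊔ c ⊔ ℓ) where
    field
      Obj   : Set i
      hom   : Obj → Obj → Carrier
      idn   : ∀ a → unit ≤ hom a a
      comp  : ∀ a b d → hom b d ⊗ hom a b ≤ hom a d
  open VCat public

  record VFun (A B : VCat) : Set (i ⊔ ℓ) where
    field
      fobj : Obj A → Obj B
      fhom : ∀ a a' → hom A a a' ≤ hom B (fobj a) (fobj a')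
  open VFun public

  _∘F_ : {A B C : VCat} → VFun B C → VFun A B → VFun A C
  _∘F_ {A} {B} {C} G F = record
    { fobj = λ a → fobj G (fobj F a)
    ; fhom = λ a a' → ≤-trans (fhom F a a') (fhom G (fobj F a) (fobj F a')) }

  _≤F_ : {A B : VCat} → VFun A B → VFun A B → Set (i ⊔ ℓ)
  _≤F_ {A} {B} F G = ∀ a → unit ≤ hom B (fobj F a) (fobj G a)

  -- equality of V-functors (a V-functor is determined by its object map)
  _≐F_ : {A B : VCat} → VFun A B → VFun A B → Set i
  _≐F_ {A} F G = ∀ a → fobj F a ≡ fobj G a

  FullyFaithful : {A B : VCat} → VFun A B → Set (i ⊔ c)
  FullyFaithful {A} {B} F = ∀ a a' → hom A a a' ≡ hom B (fobj F a) (fobj F a')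

  -- Modules R : A ⇝ B, i.e. V-functors B^op ⊗ A → V, written out:
  -- (B^op ⊗ A)((b,a),(b',a')) = B(b',b) ⊗ A(a,a') ≤ [R(b,a), R(b',a')]

  record Module (A B : VCat) : Set (i ⊔ c ⊔ ℓ) where
    field
      act  : Obj B → Obj A → Carrier
      act-hom : ∀ b b' a a' → hom B b' b ⊗ hom A a a' ≤ [ act b a , act b' a' ]
  open Module public

  private
    module ML {A B : VCat} (R : Module A B) where
      left : ∀ b b' a → act R b' a ⊗ hom B b b' ≤ act R b a
      left b b' a = adj⁻ (≤-trans (≤-trans (≤-reflexive (sym (trans (⊗-comm _ _) (⊗-identityˡ _))))
                         (⊗-monoʳ (hom B b b') (idn A a))) (act-hom R b' b a a))
      right : ∀ b a a' → act R b a ⊗ hom A a a' ≤ act R b a'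
      right b a a' = adj⁻ (≤-trans (unit≤ (idn B b)) (act-hom R b b a a'))

  _·M_ : {A B C : VCat} → Module B C → Module A B → Module A C
  _·M_ {A} {B} {C} S R = record
    { act = λ d a → ⋁ (λ b → act S d b ⊗ act R b a)
    ; act-hom = λ d d' a a' → adj
        (⋁⊗ _ _ _ λ b → ≤-trans (≤-reflexive (interchange _ _ _ _))
          (≤-trans (⊗-mono (ML.left S d' d b) (ML.right R b a a'))
            (⋁-upper (λ b → act S d' b ⊗ act R b a') b)))
    }

  module _ {A B : VCat} (R : Module A B) where
    private
      H : Obj B ⊎ Obj A → Obj B ⊎ Obj A → Carrier
      H (inj₁ b) (inj₁ b') = hom B b b'
      H (inj₂ a) (inj₂ a') = hom A a a'
      H (inj₁ b) (inj₂ a)  = act R b a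
      H (inj₂ a) (inj₁ b)  = ⊥V

      Hid : ∀ x → unit ≤ H x x
      Hid (inj₁ b) = idn B b
      Hid (inj₂ a) = idn A a

      Hcomp : ∀ x y z → H y z ⊗ H x y ≤ H x z
      Hcomp (inj₁ x) (inj₁ y) (inj₁ z) = comp B x y z
      Hcomp (inj₁ x) (inj₁ y) (inj₂ z) = ML.left R x y z
      Hcomp (inj₁ x) (inj₂ y) (inj₁ z) = ⊥⊗ _ _
      Hcomp (inj₁ x) (inj₂ y) (inj₂ z) =
        ≤-trans (≤-reflexive (⊗-comm _ _)) (ML.right R x y z)
      Hcomp (inj₂ x) (inj₁ y) z        = ⊗⊥ _ _
      Hcomp (inj₂ x) (inj₂ y) (inj₁ z) = ⊥⊗ _ _
      Hcomp (inj₂ x) (inj₂ y) (inj₂ z) = comp A x y z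

    Coll : VCat
    Coll = record { Obj = Obj B ⊎ Obj A ; hom = H ; idn = Hid ; comp = Hcomp }

    coll-i₀ : VFun B Coll
    coll-i₀ = record { fobj = inj₁ ; fhom = λ _ _ → ≤-refl }

    coll-i₁ : VFun A Coll
    coll-i₁ = record { fobj = inj₂ ; fhom = λ _ _ → ≤-refl }

  -- For f : D → X, g : D → Y, the data
  -- (P, k₀ : X → P, k₁ : Y → P) with k₀ f ≤ k₁ g is a cocomma object if
  -- for every small Z, u ↦ (u k₀ , u k₁) is an isomorphism of preorders
  -- from V-functors P → Z onto pairs (h , k) with h f ≤ k g (componentwise
  -- order).  This map is automatically monotone and lands in such pairs;
  -- so we require it to be surjective, injective and order-reflecting.

  record IsCocomma {D X Y : VCat} (f : VFun D X) (g : VFun D Y)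
                   (P : VCat) (k₀ : VFun X P) (k₁ : VFun Y P)
                   : Set (lsuc i ⊔ c ⊔ ℓ) where
    field
      cell      : (k₀ ∘F f) ≤F (k₁ ∘F g)
      surj      : (Z : VCat) (h : VFun X Z) (k : VFun Y Z) → (h ∘F f) ≤F (k ∘F g) →
                  Σ (VFun P Z) (λ u → ((u ∘F k₀) ≐F h) × ((u ∘F k₁) ≐F k))
      inj       : (Z : VCat) (u u' : VFun P Z) →
                  (u ∘F k₀) ≐F (u' ∘F k₀) → (u ∘F k₁) ≐F (u' ∘F k₁) → u ≐F u'
      reflect   : (Z : VCat) (u u' : VFun P Z) →
                  (u ∘F k₀) ≤F (u' ∘F k₀) → (u ∘F k₁) ≤F (u' ∘F k₁) → u ≤F u'

-- A comparison functor into the cocomma object is produced by its universal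
-- property once we exhibit a V-category in which Coll(S) and Coll(R) meet along
-- B and whose homs between C and A are those of Coll(S · R): the collage of the
-- module Coll(R) ⇝ C extending S by S · R.  The functor j, given by q₀ on C and
-- q₁ on A, is a V-functor because each S(c,b) ⊗ R(b,a) factors through the
-- cocomma 2-cell at b; composing it with the comparison recovers the fully
-- faithful inclusion of Coll(S · R), so j is fully faithful.
module Submission where

open import Defs
open import Level using (Level)
open import Data.Product using (Σ; _×_; _,_)
open import Data.Sum using (inj₁; inj₂)
open import Relation.Binary.Bundles using (Poset)
open import Relation.Binary.Structures using (IsPartialOrder)
open import Relation.Binary.PropositionalEquality using (_≡_; refl; sym; trans; cong₂)
import Relation.Binary.Reasoning.PartialOrder as PosetReasoning

module _ {c ℓ i : Level} (V : Quantale c ℓ i) where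
  open Quantale V

  open IsPartialOrder isPartialOrder using ()
    renaming (refl to ≤-refl; trans to ≤-trans; reflexive to ≤-reflexive; antisym to ≤-antisym)

  poset : Poset c c ℓ
  poset = record { isPartialOrder = isPartialOrder }

  open PosetReasoning poset

  ⊗-identityʳ : ∀ x → x ⊗ unit ≡ x
  ⊗-identityʳ x = trans (⊗-comm x unit) (⊗-identityˡ x)

  ⊗-monoʳ : ∀ z {x y} → x ≤ y → z ⊗ x ≤ z ⊗ y
  ⊗-monoʳ z x≤y = adj⁻ (≤-trans x≤y (adj ≤-refl))

  ⊗-monoˡ : ∀ z {x y} → x ≤ y → x ⊗ z ≤ y ⊗ z
  ⊗-monoˡ z {x} {y} x≤y = begin
    x ⊗ z ≡⟨ ⊗-comm x z ⟩
    z ⊗ x ≤⟨ ⊗-monoʳ z x≤y ⟩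
    z ⊗ y ≡⟨ ⊗-comm z y ⟩
    y ⊗ z ∎

  ⊗-mono : ∀ {x x' y y'} → x ≤ x' → y ≤ y' → x ⊗ y ≤ x' ⊗ y'
  ⊗-mono {x' = x'} {y = y} x≤x' y≤y' = ≤-trans (⊗-monoˡ y x≤x') (⊗-monoʳ x' y≤y')

  ⊥V-least : ∀ z → ⊥V V ≤ z
  ⊥V-least z = ⋁-least (λ ()) z (λ ())

  ⊗-⊥V-least : ∀ x z → x ⊗ ⊥V V ≤ z
  ⊗-⊥V-least x z = adj⁻ (⊥V-least [ x , z ])

  hom-precomp-identity : (P : VCat V) {y y' z : Obj P} →
    unit ≤ hom P y y' → hom P y' z ≤ hom P y z
  hom-precomp-identity P {y} {y'} {z} unit≤ = begin
    hom P y' z                ≡⟨ sym (⊗-identityʳ _) ⟩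
    hom P y' z ⊗ unit         ≤⟨ ⊗-monoʳ _ unit≤ ⟩
    hom P y' z ⊗ hom P y y'   ≤⟨ comp P y y' z ⟩
    hom P y z                 ∎

  act-precomp : {A B : VCat V} (M : Module V A B) (b b' : Obj B) (a : Obj A) →
    act M b' a ⊗ hom B b b' ≤ act M b a
  act-precomp {A} {B} M b b' a = adj⁻ (begin
    hom B b b'                ≡⟨ sym (⊗-identityʳ _) ⟩
    hom B b b' ⊗ unit         ≤⟨ ⊗-monoʳ _ (idn A a) ⟩
    hom B b b' ⊗ hom A a a    ≤⟨ act-hom M b' b a a ⟩
    [ act M b' a , act M b a ] ∎)

  fullyFaithful-resp-≐F : {A B : VCat V} (F G : VFun V A B) →
    _≐F_ V F G → FullyFaithful V G → FullyFaithful V F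
  fullyFaithful-resp-≐F {B = B} F G F≐G ffG a a' =
    trans (ffG a a') (cong₂ (hom B) (sym (F≐G a)) (sym (F≐G a')))

  fullyFaithful-cancelˡ : {X P Q : VCat V} (j : VFun V X P) (u : VFun V P Q) →
    FullyFaithful V (_∘F_ V u j) → FullyFaithful V j
  fullyFaithful-cancelˡ j u ff x y =
    ≤-antisym (fhom j x y) (≤-trans (fhom u _ _) (≤-reflexive (sym (ff x y))))

  module _ {A B : VCat V} (M : Module V A B) where

    collage-functor : {P : VCat V} (F : VFun V B P) (G : VFun V A P) →
      (∀ b a → act M b a ≤ hom P (fobj F b) (fobj G a)) → VFun V (Coll V M) P
    collage-functor {P} F G bound = record { fobj = obj ; fhom = mor }
      where
      obj : Obj (Coll V M) → Obj P
      obj (inj₁ b) = fobj F b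
      obj (inj₂ a) = fobj G a

      mor : ∀ x y → hom (Coll V M) x y ≤ hom P (obj x) (obj y)
      mor (inj₁ b) (inj₁ b') = fhom F b b'
      mor (inj₁ b) (inj₂ a)  = bound b a
      mor (inj₂ a) (inj₁ b)  = ⊥V-least _
      mor (inj₂ a) (inj₂ a') = fhom G a a'

    collage-≐F : {P : VCat V} (F G : VFun V (Coll V M) P) →
      _≐F_ V (_∘F_ V F (coll-i₀ V M)) (_∘F_ V G (coll-i₀ V M)) →
      _≐F_ V (_∘F_ V F (coll-i₁ V M)) (_∘F_ V G (coll-i₁ V M)) →
      _≐F_ V F G
    collage-≐F F G on-B on-A (inj₁ b) = on-B b
    collage-≐F F G on-B on-A (inj₂ a) = on-A a

  module _ {A B C : VCat V} (R : Module V A B) (S : Module V B C) where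

    composite-bounded : {P : VCat V} (h : VFun V (Coll V S) P) (k : VFun V (Coll V R) P) →
      _≤F_ V (_∘F_ V h (coll-i₁ V S)) (_∘F_ V k (coll-i₀ V R)) →
      ∀ c a → act (_·M_ V S R) c a ≤ hom P (fobj h (inj₁ c)) (fobj k (inj₂ a))
    composite-bounded {P} h k cell c a = ⋁-least _ _ through
      where
      through : ∀ b → act S c b ⊗ act R b a ≤ hom P (fobj h (inj₁ c)) (fobj k (inj₂ a))
      through b = begin
        act S c b ⊗ act R b a                   ≤⟨ ⊗-mono (fhom h (inj₁ c) (inj₂ b)) (fhom k (inj₁ b) (inj₂ a)) ⟩
        hom P hc hb ⊗ hom P kb ka               ≤⟨ ⊗-monoʳ _ (hom-precomp-identity P (cell b)) ⟩
        hom P hc hb ⊗ hom P hb ka               ≡⟨ ⊗-comm _ _ ⟩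
        hom P hb ka ⊗ hom P hc hb               ≤⟨ comp P hc hb ka ⟩
        hom P hc ka                             ∎
        where
        hc = fobj h (inj₁ c)
        hb = fobj h (inj₂ b)
        kb = fobj k (inj₁ b)
        ka = fobj k (inj₂ a)

    -- The collage of this module contains Coll(S) and Coll(R) glued along B,
    -- and Coll(S · R) as a full sub-V-category.
    pasted : Module V (Coll V R) C
    pasted = record { act = T ; act-hom = T-hom }
      where
      T : Obj C → Obj (Coll V R) → Carrier
      T c (inj₁ b) = act S c b
      T c (inj₂ a) = act (_·M_ V S R) c a

      T-hom : ∀ c c' x x' → hom C c' c ⊗ hom (Coll V R) x x' ≤ [ T c x , T c' x' ]
      T-hom c c' (inj₁ b) (inj₁ b') = act-hom S c c' b b'
      T-hom c c' (inj₁ b) (inj₂ a)  = adj (begin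
        act S c b ⊗ (hom C c' c ⊗ act R b a)   ≡⟨ sym (⊗-assoc _ _ _) ⟩
        (act S c b ⊗ hom C c' c) ⊗ act R b a   ≤⟨ ⊗-monoˡ _ (act-precomp S c' c b) ⟩
        act S c' b ⊗ act R b a                 ≤⟨ ⋁-upper (λ b'' → act S c' b'' ⊗ act R b'' a) b ⟩
        act (_·M_ V S R) c' a                  ∎)
      T-hom c c' (inj₂ a) (inj₁ b)  = ⊗-⊥V-least _ _
      T-hom c c' (inj₂ a) (inj₂ a') = act-hom (_·M_ V S R) c c' a a'

    Pasting : VCat V
    Pasting = Coll V pasted

    pasting-i₀ : VFun V (Coll V S) Pasting
    pasting-i₀ = collage-functor S (coll-i₀ V pasted) (_∘F_ V (coll-i₁ V pasted) (coll-i₀ V R))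
      (λ _ _ → ≤-refl)

    pasting-i₁ : VFun V (Coll V R) Pasting
    pasting-i₁ = coll-i₁ V pasted

    pasting-cell : _≤F_ V (_∘F_ V pasting-i₀ (coll-i₁ V S)) (_∘F_ V pasting-i₁ (coll-i₀ V R))
    pasting-cell b = idn B b

    composite-inclusion : VFun V (Coll V (_·M_ V S R)) Pasting
    composite-inclusion = collage-functor (_·M_ V S R) (coll-i₀ V pasted)
      (_∘F_ V (coll-i₁ V pasted) (coll-i₁ V R)) (λ _ _ → ≤-refl)

    composite-inclusion-fullyFaithful : FullyFaithful V composite-inclusion
    composite-inclusion-fullyFaithful (inj₁ c) (inj₁ c') = refl
    composite-inclusion-fullyFaithful (inj₁ c) (inj₂ a)  = refl
    composite-inclusion-fullyFaithful (inj₂ a) (inj₁ c)  = refl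
    composite-inclusion-fullyFaithful (inj₂ a) (inj₂ a') = refl

proposition5p6 : {c ℓ i : Level} (V : Quantale c ℓ i) {A B C : VCat V}
    (R : Module V A B) (S : Module V B C)
    (P : VCat V) (q₀ : VFun V (Coll V S) P) (q₁ : VFun V (Coll V R) P) →
    IsCocomma V (coll-i₁ V S) (coll-i₀ V R) P q₀ q₁ →
    Σ (VFun V (Coll V (_·M_ V S R)) P) (λ j →
      FullyFaithful V j ×
      (_≐F_ V (_∘F_ V j (coll-i₀ V (_·M_ V S R))) (_∘F_ V q₀ (coll-i₀ V S)) ×
       _≐F_ V (_∘F_ V j (coll-i₁ V (_·M_ V S R))) (_∘F_ V q₁ (coll-i₁ V R))))
proposition5p6 V R S P q₀ q₁ isCocomma = j , j-fullyFaithful , (λ _ → refl) , (λ _ → refl)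
  where
  open IsCocomma isCocomma
  j : VFun V (Coll V (_·M_ V S R)) P
  j = collage-functor V (_·M_ V S R) (_∘F_ V q₀ (coll-i₀ V S)) (_∘F_ V q₁ (coll-i₁ V R))
        (composite-bounded V R S q₀ q₁ cell)
  j-fullyFaithful : FullyFaithful V j
  j-fullyFaithful =
    let (u , u-q₀ , u-q₁) = surj (Pasting V R S) (pasting-i₀ V R S) (pasting-i₁ V R S) (pasting-cell V R S)
    in fullyFaithful-cancelˡ V j u
         (fullyFaithful-resp-≐F V (_∘F_ V u j) (composite-inclusion V R S)
           (collage-≐F V (_·M_ V S R) (_∘F_ V u j) (composite-inclusion V R S)
             (λ c → u-q₀ (inj₁ c)) (λ a → u-q₁ (inj₂ a)))
           (composite-inclusion-fullyFaithful V R S))
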